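{- Let $A$ be an h-lattice. Then the map $\alpha_A:A\to \mathrm{K}(A)/\theta$ given by $\alpha_A(a)=(a,a\rightarrow 0)/\theta$ is an isomorphism of h-lattices.
   Context: An h-lattice is an algebra $\langle A,\wedge,\vee,\rightarrow,0,1\rangle$ of type $(2,2,2,0,0)$ such that $\langle A,\wedge,\vee,0,1\rangle$ is a bounded distributive lattice, $a\rightarrow a=1$ and $a\wedge(a\rightarrow b)\le b$ for all $a,b$. For an h-lattice $A$, $\mathrm{K}(A)=\{(a,b)\in A\times A: a\wedge b=0\}$ with operations $(a,b)\wedge(c,d)=(a\wedge c,b\vee d)$, $(a,b)\vee(c,d)=(a\vee c,b\wedge d)$, $\sim(a,b)=(b,a)$, $(a,b)\rightarrow(c,d)=(a\rightarrow c,a\wedge d)$, constants $0=(0,1)$, $1=(1,0)$. On $\mathrm{K}(A)$, $\theta$ is the relation $x\,\theta\,y$ iff $x\rightarrow y=(1,0)$ and $y\rightarrow x=(1,0)$; it is an equivalence relation compatible with $\wedge,\vee,\rightarrow$, and $\mathrm{K}(A)/\theta$ carries the induced operations $x/\theta\wedge y/\theta=(x\wedge y)/\theta$, $x/\theta\vee y/\theta=(x\vee y)/\theta$, $x/\theta\rightarrow y/\theta=(x\rightarrow y)/\theta$ and constants $(0,1)/\theta$, $(1,0)/\theta$, making it an h-lattice. -}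

module Defs where

open import Level using (Level; suc)
open import Data.Product using (_×_; _,_; proj₁; proj₂; Σ)
open import Relation.Binary.PropositionalEquality using (_≡_)
open import Algebra.Core using (Op₂)
open import Algebra.Lattice.Structures using (IsDistributiveLattice)

record HLattice (c : Level) : Set (suc c) where
  infixr 6 _∨_
  infixr 7 _∧_
  infixr 5 _⇒_
  field
    Carrier : Set c
    _∧_ _∨_ _⇒_ : Op₂ Carrier
    𝟘 𝟙 : Carrier
    isDistributiveLattice : IsDistributiveLattice _≡_ _∨_ _∧_
    ∨-identityʳ : ∀ x → x ∨ 𝟘 ≡ x
    ∧-identityʳ : ∀ x → x ∧ 𝟙 ≡ x
    ⇒-refl : ∀ a → a ⇒ a ≡ 𝟙
    ⇒-mp : ∀ a b → (a ∧ (a ⇒ b)) ∧ b ≡ a ∧ (a ⇒ b)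

  _≤_ : Carrier → Carrier → Set c
  x ≤ y = x ∧ y ≡ x

module KConstruction {c : Level} (A : HLattice c) where
  open HLattice A

  -- K(A) is represented as the subset of A × A of pairs (a , b) with a ∧ b = 0.
  InK : Carrier × Carrier → Set c
  InK (a , b) = a ∧ b ≡ 𝟘

  _∧K_ : Op₂ (Carrier × Carrier)
  (a , b) ∧K (c' , d) = (a ∧ c' , b ∨ d)

  _∨K_ : Op₂ (Carrier × Carrier)
  (a , b) ∨K (c' , d) = (a ∨ c' , b ∧ d)

  ∼K : Carrier × Carrier → Carrier × Carrier
  ∼K (a , b) = (b , a)

  _⇒K_ : Op₂ (Carrier × Carrier)
  (a , b) ⇒K (c' , d) = (a ⇒ c' , a ∧ d)

  0K 1K : Carrier × Carrier
  0K = (𝟘 , 𝟙)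
  1K = (𝟙 , 𝟘)

  _θ_ : Carrier × Carrier → Carrier × Carrier → Set c
  x θ y = (x ⇒K y ≡ 1K) × (y ⇒K x ≡ 1K)

  α : Carrier → Carrier × Carrier
  α a = (a , a ⇒ 𝟘)

  -- α_A : A → K(A)/θ is an isomorphism of h-lattices: it is well defined
  -- (lands in K(A)), preserves ∧, ∨, →, 0, 1 (equalities in K(A)/θ are
  -- θ-relations between representatives), is injective and is surjective.
  record IsHLatticeIsoα : Set c where
    field
      α-inK       : ∀ a → InK (α a)
      α-∧         : ∀ a b → α (a ∧ b) θ (α a ∧K α b)
      α-∨         : ∀ a b → α (a ∨ b) θ (α a ∨K α b)
      α-⇒         : ∀ a b → α (a ⇒ b) θ (α a ⇒K α b)
      α-𝟘         : α 𝟘 θ 0K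
      α-𝟙         : α 𝟙 θ 1K
      α-injective : ∀ a b → α a θ α b → a ≡ b
      α-surjective : ∀ x → InK x → Σ Carrier (λ a → α a θ x)

-- θ identifies two pairs of K(A) exactly when their first components coincide:
-- a ⇒ c = 1 forces a ≤ c by modus ponens, and conversely (a , b) ⇒K (a , d) = (a ⇒ a , a ∧ d)
-- = (1 , 0) as soon as (a , d) lies in K(A). Since the first component of α a is a, and
-- a ∧ (a ⇒ 0) = 0 puts α a in K(A), each claim about α reduces to a membership in K(A),
-- i.e. to K(A) being closed under ∧K, ∨K, ⇒K and the constants.
module Submission where

open import Defs
open import Level using (Level)
open import Algebra.Lattice.Structures using (IsDistributiveLattice)
open import Data.Product using (_,_; proj₁)
open import Relation.Binary.PropositionalEquality

module HLatticeProperties {c : Level} (A : HLattice c) where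
  open HLattice A
  open IsDistributiveLattice isDistributiveLattice
    using (∧-comm; ∧-assoc; ∨-comm; ∧-absorbs-∨; ∧-distribˡ-∨; ∧-distribʳ-∨)
  open ≡-Reasoning

  ∧-zeroˡ : ∀ x → 𝟘 ∧ x ≡ 𝟘
  ∧-zeroˡ x = begin
    𝟘 ∧ x       ≡⟨ cong (𝟘 ∧_) (trans (∨-comm 𝟘 x) (∨-identityʳ x)) ⟨
    𝟘 ∧ (𝟘 ∨ x) ≡⟨ ∧-absorbs-∨ 𝟘 x ⟩
    𝟘           ∎

  ∧-zeroʳ : ∀ x → x ∧ 𝟘 ≡ 𝟘
  ∧-zeroʳ x = trans (∧-comm x 𝟘) (∧-zeroˡ x)

  ≤-antisym : ∀ {a b} → a ≤ b → b ≤ a → a ≡ b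
  ≤-antisym {a} {b} a≤b b≤a = trans (sym a≤b) (trans (∧-comm a b) b≤a)

  ⇒≡𝟙⇒≤ : ∀ {a b} → a ⇒ b ≡ 𝟙 → a ≤ b
  ⇒≡𝟙⇒≤ {a} {b} a⇒b≡𝟙 = begin
    a ∧ b             ≡⟨ cong (_∧ b) a∧[a⇒b]≡a ⟨
    (a ∧ (a ⇒ b)) ∧ b ≡⟨ ⇒-mp a b ⟩
    a ∧ (a ⇒ b)       ≡⟨ a∧[a⇒b]≡a ⟩
    a                 ∎
    where
    a∧[a⇒b]≡a : a ∧ (a ⇒ b) ≡ a
    a∧[a⇒b]≡a = trans (cong (a ∧_) a⇒b≡𝟙) (∧-identityʳ a)

  x∧[x⇒𝟘]≡𝟘 : ∀ x → x ∧ (x ⇒ 𝟘) ≡ 𝟘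
  x∧[x⇒𝟘]≡𝟘 x = trans (sym (⇒-mp x 𝟘)) (∧-zeroʳ _)

  x∧y≡𝟘⇒[z∧x]∧y≡𝟘 : ∀ {x y} z → x ∧ y ≡ 𝟘 → (z ∧ x) ∧ y ≡ 𝟘
  x∧y≡𝟘⇒[z∧x]∧y≡𝟘 {x} {y} z x∧y≡𝟘 = begin
    (z ∧ x) ∧ y ≡⟨ ∧-assoc z x y ⟩
    z ∧ (x ∧ y) ≡⟨ cong (z ∧_) x∧y≡𝟘 ⟩
    z ∧ 𝟘       ≡⟨ ∧-zeroʳ z ⟩
    𝟘           ∎

  x∧y≡𝟘⇒x∧[y∧z]≡𝟘 : ∀ {x y} z → x ∧ y ≡ 𝟘 → x ∧ (y ∧ z) ≡ 𝟘
  x∧y≡𝟘⇒x∧[y∧z]≡𝟘 {x} {y} z x∧y≡𝟘 = begin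
    x ∧ (y ∧ z) ≡⟨ ∧-assoc x y z ⟨
    (x ∧ y) ∧ z ≡⟨ cong (_∧ z) x∧y≡𝟘 ⟩
    𝟘 ∧ z       ≡⟨ ∧-zeroˡ z ⟩
    𝟘           ∎

  module KProperties where
    open KConstruction A

    InK-0K : InK 0K
    InK-0K = ∧-zeroˡ 𝟙

    InK-1K : InK 1K
    InK-1K = ∧-zeroʳ 𝟙

    InK-α : ∀ a → InK (α a)
    InK-α = x∧[x⇒𝟘]≡𝟘

    InK-∧K : ∀ {a b c′ d} → InK (a , b) → InK (c′ , d) → InK ((a , b) ∧K (c′ , d))
    InK-∧K {a} {b} {c′} {d} a∧b≡𝟘 c′∧d≡𝟘 = begin
      (a ∧ c′) ∧ (b ∨ d)              ≡⟨ ∧-distribˡ-∨ (a ∧ c′) b d ⟩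
      ((a ∧ c′) ∧ b) ∨ ((a ∧ c′) ∧ d) ≡⟨ cong₂ _∨_ [a∧c′]∧b≡𝟘 (x∧y≡𝟘⇒[z∧x]∧y≡𝟘 a c′∧d≡𝟘) ⟩
      𝟘 ∨ 𝟘                           ≡⟨ ∨-identityʳ 𝟘 ⟩
      𝟘                               ∎
      where
      [a∧c′]∧b≡𝟘 : (a ∧ c′) ∧ b ≡ 𝟘
      [a∧c′]∧b≡𝟘 = trans (cong (_∧ b) (∧-comm a c′)) (x∧y≡𝟘⇒[z∧x]∧y≡𝟘 c′ a∧b≡𝟘)

    InK-∨K : ∀ {a b c′ d} → InK (a , b) → InK (c′ , d) → InK ((a , b) ∨K (c′ , d))
    InK-∨K {a} {b} {c′} {d} a∧b≡𝟘 c′∧d≡𝟘 = begin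
      (a ∨ c′) ∧ (b ∧ d)              ≡⟨ ∧-distribʳ-∨ (b ∧ d) a c′ ⟩
      (a ∧ (b ∧ d)) ∨ (c′ ∧ (b ∧ d))  ≡⟨ cong₂ _∨_ (x∧y≡𝟘⇒x∧[y∧z]≡𝟘 d a∧b≡𝟘) c′∧[b∧d]≡𝟘 ⟩
      𝟘 ∨ 𝟘                           ≡⟨ ∨-identityʳ 𝟘 ⟩
      𝟘                               ∎
      where
      c′∧[b∧d]≡𝟘 : c′ ∧ (b ∧ d) ≡ 𝟘
      c′∧[b∧d]≡𝟘 = trans (cong (c′ ∧_) (∧-comm b d)) (x∧y≡𝟘⇒x∧[y∧z]≡𝟘 b c′∧d≡𝟘)

    InK-⇒K : ∀ x {c′ d} → InK (c′ , d) → InK (x ⇒K (c′ , d))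
    InK-⇒K (a , b) {c′} {d} c′∧d≡𝟘 = begin
      (a ⇒ c′) ∧ (a ∧ d)        ≡⟨ ∧-assoc _ a d ⟨
      ((a ⇒ c′) ∧ a) ∧ d        ≡⟨ cong (_∧ d) (∧-comm _ a) ⟩
      (a ∧ (a ⇒ c′)) ∧ d        ≡⟨ cong (_∧ d) (⇒-mp a c′) ⟨
      ((a ∧ (a ⇒ c′)) ∧ c′) ∧ d ≡⟨ x∧y≡𝟘⇒[z∧x]∧y≡𝟘 (a ∧ (a ⇒ c′)) c′∧d≡𝟘 ⟩
      𝟘                         ∎

    same-proj₁⇒θ : ∀ {a b d} → InK (a , b) → InK (a , d) → (a , b) θ (a , d)
    same-proj₁⇒θ {a} a∧b≡𝟘 a∧d≡𝟘 = cong₂ _,_ (⇒-refl a) a∧d≡𝟘 , cong₂ _,_ (⇒-refl a) a∧b≡𝟘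

    θ⇒proj₁≡ : ∀ {x y} → x θ y → proj₁ x ≡ proj₁ y
    θ⇒proj₁≡ (x⇒y≡1K , y⇒x≡1K) =
      ≤-antisym (⇒≡𝟙⇒≤ (cong proj₁ x⇒y≡1K)) (⇒≡𝟙⇒≤ (cong proj₁ y⇒x≡1K))

lemma37 : ∀ {c : Level} (A : HLattice c) → KConstruction.IsHLatticeIsoα A
lemma37 A = record
  { α-inK        = InK-α
  ; α-∧          = λ a b → same-proj₁⇒θ (InK-α (a ∧ b)) (InK-∧K (InK-α a) (InK-α b))
  ; α-∨          = λ a b → same-proj₁⇒θ (InK-α (a ∨ b)) (InK-∨K (InK-α a) (InK-α b))
  ; α-⇒          = λ a b → same-proj₁⇒θ (InK-α (a ⇒ b)) (InK-⇒K (α a) (InK-α b))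
  ; α-𝟘          = same-proj₁⇒θ (InK-α 𝟘) InK-0K
  ; α-𝟙          = same-proj₁⇒θ (InK-α 𝟙) InK-1K
  ; α-injective  = λ _ _ → θ⇒proj₁≡
  ; α-surjective = λ { (a , b) a∧b≡𝟘 → a , same-proj₁⇒θ (InK-α a) a∧b≡𝟘 }
  }
  where
  open HLattice A
  open KConstruction A
  open HLatticeProperties.KProperties A
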